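{- Let $H(X,Y,E)$ be a complete bipartite $r$-uniform hypergraph with $|X|=|Y|=r$. Then the total edge-domatic number of $H$ is $ed_t(H)=|E|/2$.
   Context: A hypergraph has a finite vertex set and a set of hyperedges, each a subset of the vertex set; it is $r$-uniform if every hyperedge has exactly $r$ vertices. A complete bipartite $r$-uniform hypergraph $H(X,Y,E)$ ($r\ge 2$) has vertex set $X\cup Y$ with $X,Y$ disjoint and nonempty, and its hyperedges are all $r$-element subsets of $X\cup Y$ containing at least one vertex of $X$ and at least one vertex of $Y$. Two distinct hyperedges are adjacent if they share at least one vertex; a hyperedge is not adjacent to itself. A total edge-dominating set is a subset $E_t\subseteq E$ such that every hyperedge in $E$ is adjacent to some hyperedge in $E_t$. The total edge-domatic number $ed_t(H)$ is the maximum number of classes in a partition of $E$ into total edge-dominating sets. -}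

module Defs where

open import Data.Nat using (ℕ; zero; suc; _+_; _≟_)
open import Data.Fin using (Fin; _↑ˡ_; _↑ʳ_)
open import Data.Fin.Subset using (Subset; _∈_; ∣_∣; inside; outside)
open import Data.Fin.Subset.Properties using (_∈?_)
open import Data.Fin.Properties using (any?)
open import Data.Vec using (_∷_; [])
open import Data.List using (List; []; _∷_; _++_; map; filter; length)
open import Data.Product using (Σ; ∃; _×_; _,_)
open import Relation.Nullary using (Dec; ¬_)
open import Relation.Nullary.Decidable using (_×-dec_)
open import Relation.Binary.PropositionalEquality using (_≡_)

-- Vertex set: Fin (r + r); X = { (i ↑ˡ r) }, Y = { (r ↑ʳ i) } (i : Fin r).

MeetsX : (r : ℕ) → Subset (r + r) → Set
MeetsX r s = ∃ λ (i : Fin r) → (i ↑ˡ r) ∈ s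

MeetsY : (r : ℕ) → Subset (r + r) → Set
MeetsY r s = ∃ λ (i : Fin r) → (r ↑ʳ i) ∈ s

IsEdge : (r : ℕ) → Subset (r + r) → Set
IsEdge r s = (∣ s ∣ ≡ r) × MeetsX r s × MeetsY r s

isEdge? : (r : ℕ) → (s : Subset (r + r)) → Dec (IsEdge r s)
isEdge? r s = (∣ s ∣ ≟ r) ×-dec
  ((any? (λ i → (i ↑ˡ r) ∈? s)) ×-dec (any? (λ i → (r ↑ʳ i) ∈? s)))

allSubsets : (n : ℕ) → List (Subset n)
allSubsets zero = [] ∷ []
allSubsets (suc n) = map (inside ∷_) (allSubsets n) ++ map (outside ∷_) (allSubsets n)

numEdges : ℕ → ℕ
numEdges r = length (filter (isEdge? r) (allSubsets (r + r)))

Adjacent : {n : ℕ} → Subset n → Subset n → Set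
Adjacent e f = ¬ (e ≡ f) × ∃ λ v → v ∈ e × v ∈ f

IsTotalEdgeDominating : (r : ℕ) → (Subset (r + r) → Set) → Set
IsTotalEdgeDominating r D =
  (D ⊆E) × (∀ e → IsEdge r e → ∃ λ f → D f × Adjacent e f)
  where
  _⊆E : (Subset (r + r) → Set) → Set
  P ⊆E = ∀ f → P f → IsEdge r f

-- a partition of E into k classes, given by a class-assignment c on
-- hyperedges (c is defined on all subsets; only its values on edges matter):
-- every class is nonempty and is a total edge-dominating set
IsTEDPartition : (r k : ℕ) → (Subset (r + r) → Fin k) → Set
IsTEDPartition r k c =
  ∀ (j : Fin k) →
    (∃ λ e → IsEdge r e × c e ≡ j) ×
    IsTotalEdgeDominating r (λ e → IsEdge r e × c e ≡ j)

HasTEDPartition : (r k : ℕ) → Set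
HasTEDPartition r k = Σ (Subset (r + r) → Fin k) (IsTEDPartition r k)

IsTotalEdgeDomaticNumber : (r m : ℕ) → Set
IsTotalEdgeDomaticNumber r m =
  HasTEDPartition r m × (∀ k → HasTEDPartition r k → k Data.Nat.≤ m)

-- The edges are exactly the r-subsets of the 2r vertices other than X and Y, so the
-- complement of an edge is an edge; and the only r-set disjoint from an r-set g is ∁ g.
-- Hence two distinct intersecting edges e, f dominate every edge g: if g met neither,
-- then e = ∁ g = f.
--
-- Every class contains an edge together with an adjacent, hence distinct, edge, so there
-- are at most |E|/2 classes.  Conversely, let H₀, …, H_{m-1} be the edges through a fixed
-- vertex; the other edges are their complements, so |E| = 2m, and the m classes
-- {H_j, ∁ H_{j+1}} (indices mod m) consist of two distinct edges that intersect
-- because H_j ≠ H_{j+1}.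
module Submission where

open import Defs
open import Data.Bool using () renaming (_≟_ to _≟ᵇ_)
open import Data.Empty using (⊥-elim)
open import Data.Fin using (Fin; zero; suc; toℕ; fromℕ; fromℕ<; inject₁; lower₁; _↑ˡ_; _↑ʳ_; splitAt; join)
open import Data.Fin.Properties using (any?; toℕ-injective; toℕ-fromℕ; toℕ-lower₁; inject₁-lower₁; join-splitAt; injective⇒≤)
open import Data.Fin.Subset using (Subset; _∈_; _⊆_; ∣_∣; inside; outside; ∁; ⊤; ⊥; ⁅_⁆)
open import Data.Fin.Subset.Properties
  using (_∈?_; ∉⊥; ∣⊤∣≡n; ∣⊥∣≡0; ∣⁅x⁆∣≡1; x∈⁅x⁆; x∈⁅y⁆⇒x≡y; x≢y⇒x∉⁅y⁆; ∣∁p∣≡n∸∣p∣;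
         x∉∁p⇒x∈p; x∉p⇒x∈∁p; x∈p⇒x∉∁p; ⊆-antisym; p⊂q⇒∣p∣<∣q∣)
open import Data.List using (List; []; _∷_; map; filter; length; lookup) renaming (_++_ to _++ₗ_)
open import Data.List.Properties using (length-++; length-map)
open import Data.List.Relation.Unary.All as All using ([])
open import Data.List.Relation.Unary.AllPairs using ([]; _∷_)
open import Data.List.Relation.Unary.Any as Any using (index)
open import Data.List.Relation.Unary.Any.Properties using (lookup-index)
open import Data.List.Relation.Unary.Unique.Propositional using (Unique)
import Data.List.Relation.Unary.Unique.Propositional.Properties as Unique
open import Data.List.Membership.Propositional using () renaming (_∈_ to _∈ₗ_; _∉_ to _∉ₗ_)
open import Data.List.Membership.Propositional.Properties
  using (∈-map⁺; ∈-map⁻; ∈-++⁺ˡ; ∈-++⁺ʳ; ∈-filter⁺; ∈-filter⁻; ∈-lookup)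
open import Data.List.Membership.Setoid.Properties using (index-injective)
import Data.List.Membership.DecPropositional as DecMembership
open import Data.Nat using (ℕ; zero; suc; _+_; _∸_; _≤_; _/_; z≤n; s≤s) renaming (_≟_ to _≟ℕ_)
open import Data.Nat.Properties using (1+n≢n; ≤-trans; ≤-reflexive; ≤-antisym; ≤⇒≯; +-identityʳ; m+n∸m≡n; *-suc; *-identityʳ)
open import Data.Nat.DivMod using (m*n/n≡m; /-monoˡ-≤)
open import Data.Product using (∃; _×_; _,_; proj₁; proj₂)
open import Data.Sum using (_⊎_; inj₁; inj₂; [_,_]′)
open import Data.Vec using ([]; _∷_; _++_; _[_]=_)
open _[_]=_
open import Data.Vec.Properties using (≡-dec; ++-injectiveʳ)
open import Data.Bool.Properties using (not-involutive)
open import Function using (id; _∘_)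
open import Function.Definitions using (Injective)
open import Relation.Binary.Definitions using (DecidableEquality)
open import Relation.Binary.PropositionalEquality
  using (_≡_; _≢_; refl; sym; trans; cong; cong₂; subst; setoid; module ≡-Reasoning)
open import Relation.Nullary using (¬_; Dec; yes; no; contradiction)
open import Relation.Nullary.Decidable using (_×-dec_; decidable-stable)

_≟ₛ_ : ∀ {n} → DecidableEquality (Subset n)
_≟ₛ_ = ≡-dec _≟ᵇ_

Intersect : ∀ {n} → Subset n → Subset n → Set
Intersect p q = ∃ λ v → v ∈ p × v ∈ q

intersect? : ∀ {n} (p q : Subset n) → Dec (Intersect p q)
intersect? p q = any? λ v → (v ∈? p) ×-dec (v ∈? q)

intersect-sym : ∀ {n} {p q : Subset n} → Intersect p q → Intersect q p
intersect-sym (v , v∈p , v∈q) = v , v∈q , v∈p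

∁-involutive : ∀ {n} (p : Subset n) → ∁ (∁ p) ≡ p
∁-involutive []      = refl
∁-involutive (x ∷ p) = cong₂ _∷_ (not-involutive x) (∁-involutive p)

∁-injective : ∀ {n} {p q : Subset n} → ∁ p ≡ ∁ q → p ≡ q
∁-injective {p = p} {q} eq = trans (sym (∁-involutive p)) (trans (cong ∁ eq) (∁-involutive q))

⊆∧∣∣≥⇒≡ : ∀ {n} {p q : Subset n} → p ⊆ q → ∣ q ∣ ≤ ∣ p ∣ → p ≡ q
⊆∧∣∣≥⇒≡ {p = p} {q} p⊆q ∣q∣≤∣p∣ = ⊆-antisym p⊆q q⊆p
  where
  q⊆p : q ⊆ p
  q⊆p {x} x∈q with x ∈? p
  ... | yes x∈p = x∈p
  ... | no  x∉p = contradiction (p⊂q⇒∣p∣<∣q∣ (p⊆q , x , x∈q , x∉p)) (≤⇒≯ ∣q∣≤∣p∣)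

disjoint⇒≡∁ : ∀ {n} {p q : Subset n} → ¬ Intersect p q → ∣ p ∣ + ∣ q ∣ ≡ n → q ≡ ∁ p
disjoint⇒≡∁ {n} {p} {q} p∤q ∣p∣+∣q∣≡n = ⊆∧∣∣≥⇒≡ q⊆∁p (≤-reflexive ∣∁p∣≡∣q∣)
  where
  q⊆∁p : q ⊆ ∁ p
  q⊆∁p x∈q = x∉p⇒x∈∁p λ x∈p → p∤q (_ , x∈p , x∈q)
  ∣∁p∣≡∣q∣ : ∣ ∁ p ∣ ≡ ∣ q ∣
  ∣∁p∣≡∣q∣ = begin
    ∣ ∁ p ∣                 ≡⟨ ∣∁p∣≡n∸∣p∣ p ⟩
    n ∸ ∣ p ∣               ≡⟨ cong (_∸ ∣ p ∣) (sym ∣p∣+∣q∣≡n) ⟩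
    (∣ p ∣ + ∣ q ∣) ∸ ∣ p ∣ ≡⟨ m+n∸m≡n ∣ p ∣ ∣ q ∣ ⟩
    ∣ q ∣                   ∎
    where open ≡-Reasoning

∣++∣ : ∀ {m n} (u : Subset m) (w : Subset n) → ∣ u ++ w ∣ ≡ ∣ u ∣ + ∣ w ∣
∣++∣ []            w = refl
∣++∣ (inside  ∷ u) w = cong suc (∣++∣ u w)
∣++∣ (outside ∷ u) w = ∣++∣ u w

↑ˡ∈++⁺ : ∀ {m n} {i : Fin m} {u : Subset m} {w : Subset n} → i ∈ u → i ↑ˡ n ∈ u ++ w
↑ˡ∈++⁺ here      = here
↑ˡ∈++⁺ (there p) = there (↑ˡ∈++⁺ p)

↑ˡ∈++⁻ : ∀ {m n} {i : Fin m} (u : Subset m) {w : Subset n} → i ↑ˡ n ∈ u ++ w → i ∈ u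
↑ˡ∈++⁻ {i = zero}  (x ∷ u) here      = here
↑ˡ∈++⁻ {i = suc i} (x ∷ u) (there p) = there (↑ˡ∈++⁻ u p)

↑ʳ∈++⁺ : ∀ {m n} {j : Fin n} (u : Subset m) {w : Subset n} → j ∈ w → m ↑ʳ j ∈ u ++ w
↑ʳ∈++⁺ []      p = p
↑ʳ∈++⁺ (x ∷ u) p = there (↑ʳ∈++⁺ u p)

↑ʳ∈++⁻ : ∀ {m n} {j : Fin n} (u : Subset m) {w : Subset n} → m ↑ʳ j ∈ u ++ w → j ∈ w
↑ʳ∈++⁻ []      p         = p
↑ʳ∈++⁻ (x ∷ u) (there p) = ↑ʳ∈++⁻ u p

∈-++⁻ : ∀ {m n} {v : Fin (m + n)} (u : Subset m) {w : Subset n} → v ∈ u ++ w →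
        (∃ λ i → v ≡ i ↑ˡ n × i ∈ u) ⊎ (∃ λ j → v ≡ m ↑ʳ j × j ∈ w)
∈-++⁻ []      p         = inj₂ (_ , refl , p)
∈-++⁻ (x ∷ u) here      = inj₁ (zero , refl , here)
∈-++⁻ (x ∷ u) (there p) with ∈-++⁻ u p
... | inj₁ (i , refl , i∈u) = inj₁ (suc i , refl , there i∈u)
... | inj₂ (j , refl , j∈w) = inj₂ (j , refl , j∈w)

Xpart Ypart : ∀ r → Subset (r + r)
Xpart r = ⊤ {r} ++ ⊥ {r}
Ypart r = ⊥ {r} ++ ⊤ {r}

∣Xpart∣ : ∀ r → ∣ Xpart r ∣ ≡ r
∣Xpart∣ r = trans (∣++∣ (⊤ {r}) (⊥ {r})) (trans (cong₂ _+_ (∣⊤∣≡n r) (∣⊥∣≡0 r)) (+-identityʳ r))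

∣Ypart∣ : ∀ r → ∣ Ypart r ∣ ≡ r
∣Ypart∣ r = trans (∣++∣ (⊥ {r}) (⊤ {r})) (cong₂ _+_ (∣⊥∣≡0 r) (∣⊤∣≡n r))

¬MeetsX∁⇒Xpart⊆ : ∀ {r} {s : Subset (r + r)} → ¬ MeetsX r (∁ s) → Xpart r ⊆ s
¬MeetsX∁⇒Xpart⊆ {r} ¬meets v∈X with ∈-++⁻ (⊤ {r}) {⊥} v∈X
... | inj₁ (i , refl , _)   = x∉∁p⇒x∈p λ v∈∁s → ¬meets (i , v∈∁s)
... | inj₂ (_ , refl , j∈⊥) = contradiction j∈⊥ ∉⊥

¬MeetsY∁⇒Ypart⊆ : ∀ {r} {s : Subset (r + r)} → ¬ MeetsY r (∁ s) → Ypart r ⊆ s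
¬MeetsY∁⇒Ypart⊆ {r} ¬meets v∈Y with ∈-++⁻ (⊥ {r}) {⊤} v∈Y
... | inj₁ (_ , refl , i∈⊥) = contradiction i∈⊥ ∉⊥
... | inj₂ (j , refl , _)   = x∉∁p⇒x∈p λ v∈∁s → ¬meets (j , v∈∁s)

¬MeetsY-Xpart : ∀ {r} → ¬ MeetsY r (Xpart r)
¬MeetsY-Xpart {r} (_ , j∈X) = ∉⊥ (↑ʳ∈++⁻ (⊤ {r}) {⊥} j∈X)

¬MeetsX-Ypart : ∀ {r} → ¬ MeetsX r (Ypart r)
¬MeetsX-Ypart {r} (_ , i∈Y) = ∉⊥ (↑ˡ∈++⁻ (⊥ {r}) {⊤} i∈Y)

∣p∣≡r⇒∣∁p∣≡r : ∀ {r} {s : Subset (r + r)} → ∣ s ∣ ≡ r → ∣ ∁ s ∣ ≡ r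
∣p∣≡r⇒∣∁p∣≡r {r} {s} ∣s∣≡r = trans (∣∁p∣≡n∸∣p∣ s) (trans (cong (r + r ∸_) ∣s∣≡r) (m+n∸m≡n r r))

meetsX-∁ : ∀ {r} {e : Subset (r + r)} → IsEdge r e → MeetsX r (∁ e)
meetsX-∁ {r} {e} (∣e∣≡r , _ , meetsY) =
  decidable-stable (any? λ i → i ↑ˡ r ∈? ∁ e) λ ¬meets →
    ¬MeetsY-Xpart (subst (MeetsY r) (sym (X≡e ¬meets)) meetsY)
  where
  X≡e : ¬ MeetsX r (∁ e) → Xpart r ≡ e
  X≡e ¬meets = ⊆∧∣∣≥⇒≡ (¬MeetsX∁⇒Xpart⊆ {s = e} ¬meets) (≤-reflexive (trans ∣e∣≡r (sym (∣Xpart∣ r))))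

meetsY-∁ : ∀ {r} {e : Subset (r + r)} → IsEdge r e → MeetsY r (∁ e)
meetsY-∁ {r} {e} (∣e∣≡r , meetsX , _) =
  decidable-stable (any? λ j → r ↑ʳ j ∈? ∁ e) λ ¬meets →
    ¬MeetsX-Ypart (subst (MeetsX r) (sym (Y≡e ¬meets)) meetsX)
  where
  Y≡e : ¬ MeetsY r (∁ e) → Ypart r ≡ e
  Y≡e ¬meets = ⊆∧∣∣≥⇒≡ (¬MeetsY∁⇒Ypart⊆ {s = e} ¬meets) (≤-reflexive (trans ∣e∣≡r (sym (∣Ypart∣ r))))

∁-isEdge : ∀ {r} {e : Subset (r + r)} → IsEdge r e → IsEdge r (∁ e)
∁-isEdge {e = e} E = ∣p∣≡r⇒∣∁p∣≡r {s = e} (proj₁ E) , meetsX-∁ E , meetsY-∁ E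

adjacent-to-pair : ∀ {r} {e f g : Subset (r + r)} → ∣ e ∣ ≡ r → ∣ f ∣ ≡ r → ∣ g ∣ ≡ r →
                   e ≢ f → Intersect e f → Adjacent g e ⊎ Adjacent g f
adjacent-to-pair {e = e} {f} {g} ∣e∣ ∣f∣ ∣g∣ e≢f e∩f
  with g ≟ₛ e | g ≟ₛ f | intersect? g e | intersect? g f
... | yes refl | _        | _        | _        = inj₂ (e≢f , e∩f)
... | no _     | yes refl | _        | _        = inj₁ (e≢f ∘ sym , intersect-sym e∩f)
... | no g≢e   | no _     | yes g∩e  | _        = inj₁ (g≢e , g∩e)
... | no _     | no g≢f   | no _     | yes g∩f  = inj₂ (g≢f , g∩f)
... | no _     | no _     | no g∤e   | no g∤f   =
  ⊥-elim (e≢f (trans (disjoint⇒≡∁ g∤e (cong₂ _+_ ∣g∣ ∣e∣))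
                     (sym (disjoint⇒≡∁ g∤f (cong₂ _+_ ∣g∣ ∣f∣)))))

pair-dominates : ∀ {r} {D : Subset (r + r) → Set} {e f} → (∀ h → D h → IsEdge r h) →
                 D e → D f → e ≢ f → Intersect e f → IsTotalEdgeDominating r D
pair-dominates {r} {D} {e} {f} D⊆E De Df e≢f e∩f = D⊆E , dominated
  where
  dominated : ∀ g → IsEdge r g → ∃ λ h → D h × Adjacent g h
  dominated g (∣g∣ , _) =
    [ (λ g~e → e , De , g~e) , (λ g~f → f , Df , g~f) ]′
      (adjacent-to-pair (proj₁ (D⊆E e De)) (proj₁ (D⊆E f Df)) ∣g∣ e≢f e∩f)

≤-length : ∀ {A : Set} {a} (xs : List A) (f : Fin a → A) → Injective _≡_ _≡_ f →
           (∀ i → f i ∈ₗ xs) → a ≤ length xs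
≤-length {A} xs f f-injective f∈xs =
  injective⇒≤ λ eq → f-injective (index-injective (setoid A) (f∈xs _) (f∈xs _) eq)

lookup-injective : ∀ {A : Set} {xs : List A} → Unique xs → Injective _≡_ _≡_ (lookup xs)
lookup-injective {xs = x ∷ xs} (_ ∷ _)      {zero}  {zero}  _  = refl
lookup-injective {xs = x ∷ xs} (x∉xs ∷ _)   {zero}  {suc j} eq = ⊥-elim (All.lookup x∉xs (∈-lookup j) eq)
lookup-injective {xs = x ∷ xs} (x∉xs ∷ _)   {suc i} {zero}  eq = ⊥-elim (All.lookup x∉xs (∈-lookup i) (sym eq))
lookup-injective {xs = x ∷ xs} (_ ∷ unique) {suc i} {suc j} eq = cong suc (lookup-injective unique eq)

splitAt-injective : ∀ m {n} → Injective _≡_ _≡_ (splitAt m {n})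
splitAt-injective m {n} {i} {j} eq =
  trans (sym (join-splitAt m n i)) (trans (cong (join m n) eq) (join-splitAt m n j))

double/2 : ∀ n → (n + n) / 2 ≡ n
double/2 n = trans (cong (_/ 2) (sym (trans (*-suc n 1) (cong (n +_) (*-identityʳ n))))) (m*n/n≡m n 2)

m+m≤n⇒m≤n/2 : ∀ {m n} → m + m ≤ n → m ≤ n / 2
m+m≤n⇒m≤n/2 {m} m+m≤n = ≤-trans (≤-reflexive (sym (double/2 m))) (/-monoˡ-≤ 2 m+m≤n)

n≤m+m⇒n/2≤m : ∀ {m n} → n ≤ m + m → n / 2 ≤ m
n≤m+m⇒n/2≤m {m} n≤m+m = ≤-trans (/-monoˡ-≤ 2 n≤m+m) (≤-reflexive (double/2 m))

allSubsets-complete : ∀ {n} (s : Subset n) → s ∈ₗ allSubsets n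
allSubsets-complete []            = Any.here refl
allSubsets-complete (inside  ∷ s) = ∈-++⁺ˡ (∈-map⁺ (inside ∷_) (allSubsets-complete s))
allSubsets-complete (outside ∷ s) =
  ∈-++⁺ʳ (map (inside ∷_) (allSubsets _)) (∈-map⁺ (outside ∷_) (allSubsets-complete s))

allSubsets-unique : ∀ n → Unique (allSubsets n)
allSubsets-unique zero    = [] ∷ []
allSubsets-unique (suc n) =
  Unique.++⁺ (Unique.map⁺ ∷-injectiveʳ (allSubsets-unique n))
             (Unique.map⁺ ∷-injectiveʳ (allSubsets-unique n)) different-heads
  where
  ∷-injectiveʳ : ∀ {b} {s t : Subset n} → b ∷ s ≡ b ∷ t → s ≡ t
  ∷-injectiveʳ refl = refl
  different-heads : ∀ {s} → ¬ (s ∈ₗ map (inside ∷_) (allSubsets n) × s ∈ₗ map (outside ∷_) (allSubsets n))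
  different-heads (s∈ins , s∈outs) with ∈-map⁻ (inside ∷_) s∈ins | ∈-map⁻ (outside ∷_) s∈outs
  ... | _ , _ , refl | _ , _ , ()

edges : ∀ r → List (Subset (r + r))
edges r = filter (isEdge? r) (allSubsets (r + r))

edges-unique : ∀ r → Unique (edges r)
edges-unique r = Unique.filter⁺ (isEdge? r) (allSubsets-unique (r + r))

∈-edges⁺ : ∀ {r} {e : Subset (r + r)} → IsEdge r e → e ∈ₗ edges r
∈-edges⁺ {r} {e} = ∈-filter⁺ (isEdge? r) (allSubsets-complete e)

∈-edges⁻ : ∀ {r} {e : Subset (r + r)} → e ∈ₗ edges r → IsEdge r e
∈-edges⁻ {r} = proj₂ ∘ ∈-filter⁻ (isEdge? r) {xs = allSubsets (r + r)}

record TwoMembers {r k} (c : Subset (r + r) → Fin k) (j : Fin k) : Set where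
  field
    edge₁ edge₂ : Subset (r + r)
    edge₁∈j     : IsEdge r edge₁ × c edge₁ ≡ j
    edge₂∈j     : IsEdge r edge₂ × c edge₂ ≡ j
    edge₁≢edge₂ : edge₁ ≢ edge₂

class-has-two-edges : ∀ {r k c} → IsTEDPartition r k c → ∀ j → TwoMembers c j
class-has-two-edges part j with part j
... | (e , e∈j) , _ , dominated with dominated e (proj₁ e∈j)
...   | f , f∈j , e≢f , _ = record
  { edge₁ = e ; edge₂ = f ; edge₁∈j = e∈j ; edge₂∈j = f∈j ; edge₁≢edge₂ = e≢f }

tedPartition⇒k+k≤numEdges : ∀ {r k} → HasTEDPartition r k → k + k ≤ numEdges r
tedPartition⇒k+k≤numEdges {r} {k} (c , part) =
  ≤-length (edges r) (pick ∘ splitAt k) (splitAt-injective k ∘ pick-injective)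
    (λ i → ∈-edges⁺ (proj₁ (pick-in-class (splitAt k i))))
  where
  module Class j = TwoMembers (class-has-two-edges part j)
  class : Fin k ⊎ Fin k → Fin k
  class = [ id , id ]′
  pick : Fin k ⊎ Fin k → Subset (r + r)
  pick (inj₁ j) = Class.edge₁ j
  pick (inj₂ j) = Class.edge₂ j
  pick-in-class : ∀ x → IsEdge r (pick x) × c (pick x) ≡ class x
  pick-in-class (inj₁ j) = Class.edge₁∈j j
  pick-in-class (inj₂ j) = Class.edge₂∈j j
  same-class : ∀ {x y} → pick x ≡ pick y → class x ≡ class y
  same-class {x} {y} eq =
    trans (sym (proj₂ (pick-in-class x))) (trans (cong c eq) (proj₂ (pick-in-class y)))
  pick-injective : Injective _≡_ _≡_ pick
  pick-injective {inj₁ i} {inj₁ j} eq = cong inj₁ (same-class {inj₁ i} {inj₁ j} eq)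
  pick-injective {inj₂ i} {inj₂ j} eq = cong inj₂ (same-class {inj₂ i} {inj₂ j} eq)
  pick-injective {inj₁ i} {inj₂ j} eq with same-class {inj₁ i} {inj₂ j} eq
  ... | refl = ⊥-elim (Class.edge₁≢edge₂ i eq)
  pick-injective {inj₂ i} {inj₁ j} eq with same-class {inj₂ i} {inj₁ j} eq
  ... | refl = ⊥-elim (Class.edge₁≢edge₂ i (sym eq))

predMod : ∀ {n} → Fin n → Fin n
predMod {suc n} zero    = fromℕ n
predMod {suc n} (suc i) = inject₁ i

sucMod : ∀ {n} → Fin n → Fin n
sucMod {suc n} i with n ≟ℕ toℕ i
... | yes _   = zero
... | no n≢i  = suc (lower₁ i n≢i)

predMod-sucMod : ∀ {n} (i : Fin n) → predMod (sucMod i) ≡ i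
predMod-sucMod {suc n} i with n ≟ℕ toℕ i
... | yes n≡i = toℕ-injective (trans (toℕ-fromℕ n) n≡i)
... | no  n≢i = inject₁-lower₁ i n≢i

sucMod-≢ : ∀ {n} → 2 ≤ n → (i : Fin n) → sucMod i ≢ i
sucMod-≢ {suc n} (s≤s 1≤n) i with n ≟ℕ toℕ i
... | yes n≡i = λ { refl → contradiction (subst (1 ≤_) n≡i 1≤n) λ () }
... | no  n≢i = λ eq → 1+n≢n (trans (cong suc (sym (toℕ-lower₁ i n≢i))) (cong toℕ eq))

module _ {r} (H : List (Subset (r + r))) (H-unique : Unique H)
         (∁-∉ : ∀ {e} → e ∈ₗ H → ∁ e ∉ₗ H) (2≤m : 2 ≤ length H) where

  open DecMembership (_≟ₛ_ {r + r}) using () renaming (_∈?_ to _∈ₗ?_)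

  -- Class j is {H j, ∁ H (j + 1 mod m)}.  Subsets that are neither get a junk class,
  -- which is harmless: enlarging a class keeps it dominating.
  classOf : Subset (r + r) → Fin (length H)
  classOf s with s ∈ₗ? H
  ... | yes s∈H = index s∈H
  ... | no _ with ∁ s ∈ₗ? H
  ...   | yes ∁s∈H = predMod (index ∁s∈H)
  ...   | no _     = fromℕ< 2≤m

  classOf-lookup : ∀ j → classOf (lookup H j) ≡ j
  classOf-lookup j with lookup H j ∈ₗ? H
  ... | yes p = lookup-injective H-unique (sym (lookup-index p))
  ... | no ∉H = contradiction (∈-lookup j) ∉H

  classOf-∁-lookup : ∀ i → classOf (∁ (lookup H i)) ≡ predMod i
  classOf-∁-lookup i with ∁ (lookup H i) ∈ₗ? H
  ... | yes p = contradiction p (∁-∉ (∈-lookup i))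
  ... | no _ with ∁ (∁ (lookup H i)) ∈ₗ? H
  ...   | yes q = cong predMod (lookup-injective H-unique (trans (sym (lookup-index q)) (∁-involutive _)))
  ...   | no ∉H = contradiction (subst (_∈ₗ H) (sym (∁-involutive _)) (∈-lookup i)) ∉H

  complement-pairing : (∀ {e} → e ∈ₗ H → IsEdge r e) → HasTEDPartition r (length H)
  complement-pairing H⊆E = classOf , λ j →
    (E j , E-in-class j) , pair-dominates (λ _ → proj₁) (E-in-class j) (F-in-class j) (E≢F j) (E∩F j)
    where
    E F : Fin (length H) → Subset (r + r)
    E j = lookup H j
    F j = ∁ (lookup H (sucMod j))
    E-in-class : ∀ j → IsEdge r (E j) × classOf (E j) ≡ j
    E-in-class j = H⊆E (∈-lookup j) , classOf-lookup j
    F-in-class : ∀ j → IsEdge r (F j) × classOf (F j) ≡ j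
    F-in-class j = ∁-isEdge (H⊆E (∈-lookup (sucMod j))) , trans (classOf-∁-lookup (sucMod j)) (predMod-sucMod j)
    E≢F : ∀ j → E j ≢ F j
    E≢F j eq = ∁-∉ (∈-lookup (sucMod j)) (subst (_∈ₗ H) eq (∈-lookup j))
    E∩F : ∀ j → Intersect (E j) (F j)
    E∩F j = decidable-stable (intersect? (E j) (F j)) λ E∤F →
      sucMod-≢ 2≤m j (lookup-injective H-unique (∁-injective
        (disjoint⇒≡∁ E∤F (cong₂ _+_ (proj₁ (proj₁ (E-in-class j))) (proj₁ (proj₁ (F-in-class j)))))))

edgesAt0 : ∀ k → List (Subset (suc k + suc k))
edgesAt0 k = filter (zero ∈?_) (edges (suc k))

edgesAt0-unique : ∀ k → Unique (edgesAt0 k)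
edgesAt0-unique k = Unique.filter⁺ (zero ∈?_) (edges-unique (suc k))

∈-edgesAt0⁺ : ∀ {k} {e : Subset (suc k + suc k)} → IsEdge (suc k) e → zero ∈ e → e ∈ₗ edgesAt0 k
∈-edgesAt0⁺ E 0∈e = ∈-filter⁺ (zero ∈?_) (∈-edges⁺ E) 0∈e

∈-edgesAt0⁻ : ∀ {k} {e : Subset (suc k + suc k)} → e ∈ₗ edgesAt0 k → IsEdge (suc k) e × zero ∈ e
∈-edgesAt0⁻ {k} e∈H with ∈-filter⁻ (zero ∈?_) {xs = edges (suc k)} e∈H
... | e∈E , 0∈e = ∈-edges⁻ e∈E , 0∈e

∁-∉-edgesAt0 : ∀ {k} {e : Subset (suc k + suc k)} → e ∈ₗ edgesAt0 k → ∁ e ∉ₗ edgesAt0 k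
∁-∉-edgesAt0 e∈H ∁e∈H = x∈p⇒x∉∁p (proj₂ (∈-edgesAt0⁻ e∈H)) (proj₂ (∈-edgesAt0⁻ ∁e∈H))

∈-edgesAt0-or-∁ : ∀ {k} {e : Subset (suc k + suc k)} → IsEdge (suc k) e →
                  e ∈ₗ edgesAt0 k ++ₗ map ∁ (edgesAt0 k)
∈-edgesAt0-or-∁ {k} {e} E with zero ∈? e
... | yes 0∈e = ∈-++⁺ˡ (∈-edgesAt0⁺ E 0∈e)
... | no  0∉e = ∈-++⁺ʳ (edgesAt0 k) (subst (_∈ₗ map ∁ (edgesAt0 k)) (∁-involutive e)
                  (∈-map⁺ ∁ (∈-edgesAt0⁺ (∁-isEdge E) (x∉p⇒x∈∁p 0∉e))))

numEdges≤double-edgesAt0 : ∀ k → numEdges (suc k) ≤ length (edgesAt0 k) + length (edgesAt0 k)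
numEdges≤double-edgesAt0 k = ≤-trans
  (≤-length (H ++ₗ map ∁ H) (lookup (edges (suc k))) (lookup-injective (edges-unique (suc k)))
            (λ i → ∈-edgesAt0-or-∁ (∈-edges⁻ (∈-lookup i))))
  (≤-reflexive (trans (length-++ H) (cong (length H +_) (length-map ∁ H))))
  where
  H = edgesAt0 k

spike : ∀ {n} → Fin (suc n) → Subset (suc n + suc n)
spike {n} i = ⁅ zero {n} ⁆ ++ ∁ ⁅ i ⁆

spike-isEdge : ∀ {n} → 2 ≤ suc n → ∀ i → IsEdge (suc n) (spike i)
spike-isEdge {n} 2≤r i =
  trans (∣++∣ ⁅ zero {n} ⁆ (∁ ⁅ i ⁆))
        (cong₂ _+_ (∣⁅x⁆∣≡1 (zero {n})) (trans (∣∁p∣≡n∸∣p∣ ⁅ i ⁆) (cong (suc n ∸_) (∣⁅x⁆∣≡1 i))))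
  , (zero , ↑ˡ∈++⁺ {w = ∁ ⁅ i ⁆} (x∈⁅x⁆ zero))
  , (sucMod i , ↑ʳ∈++⁺ ⁅ zero {n} ⁆ (x∉p⇒x∈∁p (x≢y⇒x∉⁅y⁆ (sucMod-≢ 2≤r i))))

spike-injective : ∀ {n} → Injective _≡_ _≡_ (spike {n})
spike-injective {n} {i} {j} eq =
  x∈⁅y⁆⇒x≡y j (subst (i ∈_) (∁-injective (++-injectiveʳ ⁅ zero {n} ⁆ ⁅ zero ⁆ eq)) (x∈⁅x⁆ i))

r≤length-edgesAt0 : ∀ k → suc (suc k) ≤ length (edgesAt0 (suc k))
r≤length-edgesAt0 k = ≤-length (edgesAt0 (suc k)) spike spike-injective
  λ i → ∈-edgesAt0⁺ {suc k} (spike-isEdge (s≤s (s≤s z≤n)) i) here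

theorem10 : (r : ℕ) → 2 ≤ r → IsTotalEdgeDomaticNumber r (numEdges r / 2)
theorem10 (suc (suc k)) 2≤r@(s≤s (s≤s _)) =
  subst (HasTEDPartition r) m≡|E|/2 partition , λ _ → m+m≤n⇒m≤n/2 ∘ tedPartition⇒k+k≤numEdges
  where
  r = suc (suc k)
  H = edgesAt0 (suc k)
  partition : HasTEDPartition r (length H)
  partition = complement-pairing H (edgesAt0-unique (suc k)) (∁-∉-edgesAt0 {suc k})
                (≤-trans 2≤r (r≤length-edgesAt0 k)) (proj₁ ∘ ∈-edgesAt0⁻ {suc k})
  m≡|E|/2 : length H ≡ numEdges r / 2
  m≡|E|/2 = ≤-antisym (m+m≤n⇒m≤n/2 (tedPartition⇒k+k≤numEdges partition)) (n≤m+m⇒n/2≤m (numEdges≤double-edgesAt0 (suc k)))
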